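{- For all positive integers $k$ and all $n\ge0$, there is a bijection between $\mathcal{A}^k_n$ and $\overline{\mathcal{Q}}^k_n$.
   Context: For a positive integer $k$, $\overline{\mathcal{Q}}^k_n$ (the $k$-quasi-Stirling permutations) is the set of permutations of the multiset $\{1^k,2^k,\dots,n^k\}$ ($k$ copies of each $i\in[n]$) that avoid the patterns $1212$ and $2121$, i.e. there are no indices $i<j<l<m$ with $\pi_i=\pi_l$ and $\pi_j=\pi_m$ and $\pi_i\neq\pi_j$. A $k$-ary tree is a plane (ordered) rooted tree in which every vertex has either $0$ or $k$ children, and whose internal (non-leaf) vertices receive distinct labels from $1$ up to the number of internal vertices (leaves are unlabeled). $\mathcal{A}^k_n$ is the set of $k$-ary trees with $n$ internal vertices. -}

module Defs where

open import Data.Nat using (ℕ; zero; suc; _<_)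
open import Data.List using (List; []; _∷_; _++_; map; upTo; replicate; concatMap; length; lookup)
open import Data.Vec using (Vec; []; _∷_)
open import Data.Fin using (Fin; toℕ)
open import Data.Product using (∃; _×_; Σ-syntax)
open import Relation.Binary.PropositionalEquality using (_≡_; _≢_)
open import Relation.Nullary using (¬_)
open import Data.List.Relation.Binary.Permutation.Propositional using (_↭_)

[1‥_] : ℕ → List ℕ
[1‥ n ] = map suc (upTo n)

data Tree (k : ℕ) : Set where
  leaf : Tree k
  node : ℕ → Vec (Tree k) k → Tree k

mutual
  labels : ∀ {k} → Tree k → List ℕ
  labels leaf        = []
  labels (node a ts) = a ∷ labelsVec ts

  labelsVec : ∀ {k m} → Vec (Tree k) m → List ℕ
  labelsVec []       = []
  labelsVec (t ∷ ts) = labels t ++ labelsVec ts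

-- A^k_n : k-ary trees with n internal vertices labelled by distinct
-- labels 1..n, i.e. the label list is a permutation of [1..n].
-- The proof field is irrelevant, so elements are determined by the tree.
record KAryTree (k n : ℕ) : Set where
  constructor mkTree
  field
    tree : Tree k
    .labelled : labels tree ↭ [1‥ n ]

multiset : ℕ → ℕ → List ℕ
multiset k n = concatMap (λ i → replicate k i) [1‥ n ]

Contains1212or2121 : List ℕ → Set
Contains1212or2121 w =
  ∃ λ (i : Fin (length w)) → ∃ λ (j : Fin (length w)) →
  ∃ λ (l : Fin (length w)) → ∃ λ (m : Fin (length w)) →
    (toℕ i < toℕ j) × (toℕ j < toℕ l) × (toℕ l < toℕ m) ×
    (lookup w i ≡ lookup w l) × (lookup w j ≡ lookup w m) ×
    (lookup w i ≢ lookup w j)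

record QuasiStirling (k n : ℕ) : Set where
  constructor mkQS
  field
    word : List ℕ
    .isPerm : word ↭ multiset k n
    .avoids : ¬ Contains1212or2121 word

-- A k-ary tree whose root is labelled a and has subtrees T₁, …, Tₖ is sent to
-- the word  a w(T₁) a w(T₂) … a w(Tₖ).  Every label occurs exactly k times, and
-- since the subtrees carry disjoint sets of labels not containing a, a pattern
-- x y x y can neither straddle two blocks w(Tᵢ) nor use a letter a.  Conversely,
-- a quasi-Stirling word a r is cut at the k − 1 further occurrences of its first
-- letter a; avoiding 1212 and 2121 forces the pieces to have disjoint alphabets,
-- so each piece is again a quasi-Stirling word and decodes to a subtree.

module Submission where

open import Defs
open import Data.Nat using (ℕ; zero; suc; _+_; _*_; _≤_; _<_; z≤n; s≤s; _≟_)
open import Data.Nat.Properties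
open import Data.Nat.ListAction using (sum)
open import Data.Nat.ListAction.Properties using (sum-++; sum-↭)
open import Data.Nat.Tactic.RingSolver using (solve-∀)
open import Data.Fin using (zero; suc; toℕ)
open import Data.List using (List; []; _∷_; _++_; map; replicate; concatMap; length; lookup; drop)
open import Data.List.Properties using (map-++; ++-identityʳ; ∷-injective; length-++-≤ˡ; length-++-≤ʳ; ≡-dec)
open import Data.List.Membership.Propositional using (_∈_; _∉_)
open import Data.List.Membership.Propositional.Properties using (∈-++⁺ˡ; ∈-++⁺ʳ; ∈-++⁻)
open import Data.List.Membership.DecPropositional _≟_ using (_∈?_)
open import Data.List.Relation.Unary.Any using (here; there)
open import Data.List.Relation.Unary.All.Properties using (All¬⇒¬Any)
open import Data.List.Relation.Unary.AllPairs using ([]; _∷_)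
open import Data.List.Relation.Unary.Unique.Propositional using (Unique)
import Data.List.Relation.Unary.Unique.Propositional.Properties as Unique
open import Data.List.Relation.Binary.Disjoint.Propositional using (Disjoint)
open import Data.List.Relation.Binary.Permutation.Propositional
  using (_↭_; prep; ↭-refl; module PermutationReasoning)
open import Data.List.Relation.Binary.Permutation.Propositional.Properties using (shift; map⁺)
open import Data.List.Relation.Binary.Sublist.Propositional
  using (_⊆_; _⊈_; []; _∷_; _∷ʳ_; ⊆-refl; ⊆-trans; minimum; to∈; from∈)
open import Data.List.Relation.Binary.Sublist.Propositional.Properties
  using (drop⁺-≥; ∷ˡ⁻; ++⁺; ++⁺ˡ; ++⁺ʳ)
open import Data.Vec using (Vec; []; _∷_)
import Data.Vec as V
import Data.Vec.Properties as V
open import Data.Product using (_×_; _,_; proj₁; proj₂; ∃; ∃₂; map₁)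
open import Data.Sum using (_⊎_; inj₁; inj₂)
open import Function using (_∘′_; case_of_)
open import Function.Bundles using (_⤖_; mk⤖)
open import Function.Definitions using (Injective; Surjective)
open import Relation.Nullary using (¬_; yes; no; contradiction)
open import Relation.Nullary.Decidable using (map′; _×-dec_; recompute)
open import Relation.Binary.Definitions using (DecidableEquality)
open import Relation.Binary.PropositionalEquality

-- Occurrence counts

δ : ℕ → ℕ → ℕ
δ z x with z ≟ x
... | yes _ = 1
... | no  _ = 0

count : ℕ → List ℕ → ℕ
count z xs = sum (map (δ z) xs)

count-here : ∀ z xs → count z (z ∷ xs) ≡ suc (count z xs)
count-here z xs with z ≟ z
... | yes _   = refl
... | no z≢z = contradiction refl z≢z

count-there : ∀ {z x} xs → z ≢ x → count z (x ∷ xs) ≡ count z xs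
count-there {z} {x} xs z≢x with z ≟ x
... | yes z≡x = contradiction z≡x z≢x
... | no  _   = refl

count-++ : ∀ z xs ys → count z (xs ++ ys) ≡ count z xs + count z ys
count-++ z xs ys = trans (cong sum (map-++ (δ z) xs ys)) (sum-++ (map (δ z) xs) _)

↭⇒count≡ : ∀ {xs ys} → xs ↭ ys → ∀ z → count z xs ≡ count z ys
↭⇒count≡ p z = sum-↭ (map⁺ (δ z) p)

count-replicate : ∀ z k x → count z (replicate k x) ≡ k * δ z x
count-replicate z zero    x = refl
count-replicate z (suc k) x = cong (δ z x +_) (count-replicate z k x)

count-concatMap-replicate : ∀ z k xs → count z (concatMap (replicate k) xs) ≡ k * count z xs
count-concatMap-replicate z k []       = sym (*-zeroʳ k)
count-concatMap-replicate z k (x ∷ xs) = begin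
  count z (replicate k x ++ concatMap (replicate k) xs)
    ≡⟨ count-++ z (replicate k x) _ ⟩
  count z (replicate k x) + count z (concatMap (replicate k) xs)
    ≡⟨ cong₂ _+_ (count-replicate z k x) (count-concatMap-replicate z k xs) ⟩
  k * δ z x + k * count z xs
    ≡⟨ *-distribˡ-+ k (δ z x) _ ⟨
  k * count z (x ∷ xs)
    ∎
  where open ≡-Reasoning

count-mono-⊆ : ∀ {xs ys} → xs ⊆ ys → ∀ z → count z xs ≤ count z ys
count-mono-⊆ []         z = z≤n
count-mono-⊆ (y ∷ʳ τ)   z = ≤-trans (count-mono-⊆ τ z) (m≤n+m _ (δ z y))
count-mono-⊆ (refl ∷ τ) z = +-monoʳ-≤ _ (count-mono-⊆ τ z)

∈⇒0<count : ∀ {z xs} → z ∈ xs → 0 < count z xs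
∈⇒0<count {z} {z ∷ xs} (here refl) = subst (0 <_) (sym (count-here z xs)) (s≤s z≤n)
∈⇒0<count {z} {x ∷ xs} (there z∈)  = ≤-trans (∈⇒0<count z∈) (m≤n+m _ (δ z x))

∉⇒count≡0 : ∀ {z xs} → z ∉ xs → count z xs ≡ 0
∉⇒count≡0 {z} {[]}     _  = refl
∉⇒count≡0 {z} {x ∷ xs} z∉ =
  trans (count-there xs λ { refl → z∉ (here refl) }) (∉⇒count≡0 (z∉ ∘′ there))

0<count⇒∈ : ∀ {z xs} → 0 < count z xs → z ∈ xs
0<count⇒∈ {z} {xs} pos with z ∈? xs
... | yes z∈xs = z∈xs
... | no  z∉xs = contradiction (∉⇒count≡0 z∉xs) (>⇒≢ pos)

disjoint⇒count≡0 : ∀ {xs ys} → Disjoint xs ys → ∀ z → count z xs ≡ 0 ⊎ count z ys ≡ 0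
disjoint⇒count≡0 {xs} xs#ys z with z ∈? xs
... | yes z∈xs = inj₂ (∉⇒count≡0 λ z∈ys → xs#ys (z∈xs , z∈ys))
... | no  z∉xs = inj₁ (∉⇒count≡0 z∉xs)

disjoint-∷ʳ⁻ : ∀ {xs y} {ys : List ℕ} → Disjoint xs (y ∷ ys) → y ∉ xs × Disjoint xs ys
disjoint-∷ʳ⁻ xs#yys =
  (λ y∈xs → xs#yys (y∈xs , here refl)) , (λ (z∈xs , z∈ys) → xs#yys (z∈xs , there z∈ys))

breakAt : ℕ → List ℕ → List ℕ × List ℕ
breakAt a []      = [] , []
breakAt a (x ∷ w) with x ≟ a
... | yes _ = [] , w
... | no  _ = map₁ (x ∷_) (breakAt a w)

breakAt-spec : ∀ {a} w → a ∈ w → let (p , q) = breakAt a w in w ≡ p ++ a ∷ q × a ∉ p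
breakAt-spec {a} (x ∷ w) a∈ with x ≟ a | a∈
... | yes refl | _          = refl , λ ()
... | no  x≢a  | here refl  = contradiction refl x≢a
... | no  x≢a  | there a∈w =
  let (w≡ , a∉p) = breakAt-spec w a∈w
  in cong (x ∷_) w≡ , λ { (here refl) → x≢a refl ; (there a∈p) → a∉p a∈p }

breakAt-++ : ∀ {a} p q → a ∉ p → breakAt a (p ++ a ∷ q) ≡ (p , q)
breakAt-++ {a} []      q _  with a ≟ a
... | yes _   = refl
... | no a≢a = contradiction refl a≢a
breakAt-++ {a} (x ∷ p) q a∉ with x ≟ a
... | yes refl = contradiction (here refl) a∉
... | no  _    = cong (map₁ (x ∷_)) (breakAt-++ p q (a∉ ∘′ there))

count≡⇒↭ : ∀ xs ys → (∀ z → count z xs ≡ count z ys) → xs ↭ ys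
count≡⇒↭ []       []       _  = ↭-refl
count≡⇒↭ []       (y ∷ ys) eq = contradiction (trans (eq y) (count-here y ys)) λ ()
count≡⇒↭ (x ∷ xs) ys       eq = begin
  x ∷ xs      ↭⟨ prep x (count≡⇒↭ xs (p ++ q) eq′) ⟩
  x ∷ p ++ q  ↭⟨ shift x p q ⟨
  p ++ x ∷ q  ≡⟨ ys≡ ⟨
  ys          ∎
  where
  open PermutationReasoning
  p = proj₁ (breakAt x ys)
  q = proj₂ (breakAt x ys)
  ys≡ : ys ≡ p ++ x ∷ q
  ys≡ = proj₁ (breakAt-spec ys (0<count⇒∈ (subst (0 <_) (trans (sym (count-here x xs)) (eq x)) (s≤s z≤n))))
  eq′ : ∀ z → count z xs ≡ count z (p ++ q)
  eq′ z = +-cancelˡ-≡ (δ z x) _ _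
    (trans (eq z) (trans (cong (count z) ys≡) (↭⇒count≡ (shift x p q) z)))

Distinct : List ℕ → Set
Distinct xs = ∀ z → count z xs ≤ 1

Unique⇒Distinct : ∀ {xs} → Unique xs → Distinct xs
Unique⇒Distinct {[]}     []             z = z≤n
Unique⇒Distinct {x ∷ xs} (x∉xs ∷ uniq) z = case z ≟ x of λ where
  (yes refl) → ≤-reflexive (trans (count-here z xs) (cong suc (∉⇒count≡0 (All¬⇒¬Any x∉xs))))
  (no z≢x)   → ≤-trans (≤-reflexive (count-there xs z≢x)) (Unique⇒Distinct uniq z)

distinct-[1‥] : ∀ n → Distinct [1‥ n ]
distinct-[1‥] n = Unique⇒Distinct (Unique.map⁺ suc-injective (Unique.upTo⁺ n))

distinct-resp-↭ : ∀ {xs ys} → xs ↭ ys → Distinct ys → Distinct xs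
distinct-resp-↭ p dys z = subst (_≤ 1) (sym (↭⇒count≡ p z)) (dys z)

distinct-⊆ : ∀ {xs ys} → xs ⊆ ys → Distinct ys → Distinct xs
distinct-⊆ τ d z = ≤-trans (count-mono-⊆ τ z) (d z)

distinct-++⁻ˡ : ∀ xs ys → Distinct (xs ++ ys) → Distinct xs
distinct-++⁻ˡ xs ys = distinct-⊆ (++⁺ʳ ys (⊆-refl {x = xs}))

distinct-++⁻ʳ : ∀ xs ys → Distinct (xs ++ ys) → Distinct ys
distinct-++⁻ʳ xs ys = distinct-⊆ (++⁺ˡ xs (⊆-refl {x = ys}))

distinct-∷-++⁻ʳ : ∀ a xs ys → Distinct (a ∷ xs ++ ys) → Distinct (a ∷ ys)
distinct-∷-++⁻ʳ a xs ys = distinct-⊆ (refl ∷ ++⁺ˡ xs (⊆-refl {x = ys}))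

distinct-++⇒disjoint : ∀ xs ys → Distinct (xs ++ ys) → Disjoint xs ys
distinct-++⇒disjoint xs ys d {z} (z∈xs , z∈ys) =
  <⇒≱ (+-mono-≤ (∈⇒0<count z∈xs) (∈⇒0<count z∈ys)) (subst (_≤ 1) (count-++ z xs ys) (d z))

distinct-∷⁻ : ∀ a xs → Distinct (a ∷ xs) → a ∉ xs × Distinct xs
distinct-∷⁻ a xs d =
  (λ a∈xs → distinct-++⇒disjoint (a ∷ []) xs d (here refl , a∈xs)) , distinct-++⁻ʳ (a ∷ []) xs d

Uniform : ℕ → List ℕ → ℕ → Set
Uniform k w z = count z w ≡ 0 ⊎ count z w ≡ k

uniform-resp : ∀ {k z} v w → count z v ≡ count z w → Uniform k v z → Uniform k w z
uniform-resp {k} _ _ = subst (λ c → c ≡ 0 ⊎ c ≡ k)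

uniform-there : ∀ {k z x} xs → z ≢ x → Uniform k (x ∷ xs) z → Uniform k xs z
uniform-there xs z≢x = uniform-resp (_ ∷ xs) xs (count-there xs z≢x)

uniform-++ : ∀ {k} xs ys → Disjoint xs ys → ∀ z → Uniform k (xs ++ ys) z → Uniform k xs z × Uniform k ys z
uniform-++ xs ys xs#ys z u with disjoint⇒count≡0 xs#ys z
... | inj₁ xs₀ = inj₁ xs₀ , uniform-resp (xs ++ ys) ys (trans (count-++ z xs ys) (cong (_+ count z ys) xs₀)) u
... | inj₂ ys₀ =
  uniform-resp (xs ++ ys) xs (trans (count-++ z xs ys) (trans (cong (count z xs +_) ys₀) (+-identityʳ _))) u ,
  inj₁ ys₀

uniform-concatMap-replicate : ∀ {k xs w} → Distinct xs → w ↭ concatMap (replicate k) xs → ∀ z → Uniform k w z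
uniform-concatMap-replicate {k} {xs} d p z
  with count z xs | d z | trans (↭⇒count≡ p z) (count-concatMap-replicate z k xs)
... | zero        | _      | w₀ = inj₁ (trans w₀ (*-zeroʳ k))
... | suc zero    | _      | wₖ = inj₂ (trans wₖ (*-identityʳ k))
... | suc (suc _) | s≤s () | _

-- Patterns as subsequences

module _ {A : Set} where

  drop-lookup : ∀ (w : List A) i → drop (toℕ i) w ≡ lookup w i ∷ drop (suc (toℕ i)) w
  drop-lookup (x ∷ w) zero    = refl
  drop-lookup (x ∷ w) (suc i) = drop-lookup w i

  lookup∷⊆drop : ∀ {xs} (w : List A) i → xs ⊆ drop (suc (toℕ i)) w → lookup w i ∷ xs ⊆ drop (toℕ i) w
  lookup∷⊆drop {xs} w i τ = subst (lookup w i ∷ xs ⊆_) (sym (drop-lookup w i)) (refl ∷ τ)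

  ∷⊆drop⁻ : ∀ {x xs} b (w : List A) → x ∷ xs ⊆ drop b w →
            ∃ λ i → b ≤ toℕ i × lookup w i ≡ x × xs ⊆ drop (suc (toℕ i)) w
  ∷⊆drop⁻ zero    (y ∷ w) (refl ∷ τ) = zero , z≤n , refl , τ
  ∷⊆drop⁻ zero    (y ∷ w) (.y ∷ʳ τ) =
    let (i , _ , wᵢ≡x , σ) = ∷⊆drop⁻ zero w τ in suc i , z≤n , wᵢ≡x , σ
  ∷⊆drop⁻ (suc b) (y ∷ w) τ =
    let (i , b≤i , wᵢ≡x , σ) = ∷⊆drop⁻ b w τ in suc i , s≤s b≤i , wᵢ≡x , σ

  ⊆-++⁻ : ∀ {xs} (s r : List A) → xs ⊆ s ++ r → ∃₂ λ u v → xs ≡ u ++ v × u ⊆ s × v ⊆ r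
  ⊆-++⁻ []      r τ          = [] , _ , refl , [] , τ
  ⊆-++⁻ (c ∷ s) r (.c ∷ʳ τ) =
    let (u , v , xs≡ , τs , τr) = ⊆-++⁻ s r τ in u , v , xs≡ , c ∷ʳ τs , τr
  ⊆-++⁻ (c ∷ s) r (refl ∷ τ) =
    let (u , v , xs≡ , τs , τr) = ⊆-++⁻ s r τ in c ∷ u , v , cong (c ∷_) xs≡ , refl ∷ τs , τr

aba : ℕ → ℕ → List ℕ
aba x y = x ∷ y ∷ x ∷ []

abab : ℕ → ℕ → List ℕ
abab x y = x ∷ aba y x

ContainsABAB : List ℕ → Set
ContainsABAB w = ∃₂ λ x y → x ≢ y × abab x y ⊆ w

containsABAB-mono : ∀ {v w} → v ⊆ w → ContainsABAB v → ContainsABAB w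
containsABAB-mono v⊆w (x , y , x≢y , τ) = x , y , x≢y , ⊆-trans τ v⊆w

Contains1212or2121⇒ABAB : ∀ w → Contains1212or2121 w → ContainsABAB w
Contains1212or2121⇒ABAB w (i , j , l , m , i<j , j<l , l<m , wᵢ≡wₗ , wⱼ≡wₘ , wᵢ≢wⱼ) =
  lookup w i , lookup w j , wᵢ≢wⱼ ,
  subst₂ (λ c d → lookup w i ∷ lookup w j ∷ c ∷ d ∷ [] ⊆ w) (sym wᵢ≡wₗ) (sym wⱼ≡wₘ)
    (⊆-trans (lookup∷⊆drop w i (step j i<j (step l j<l (step m l<m (minimum _))))) (drop⁺-≥ {m = toℕ i} z≤n))
  where
  step : ∀ {b xs} k → b < toℕ k → xs ⊆ drop (suc (toℕ k)) w → lookup w k ∷ xs ⊆ drop (suc b) w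
  step k b<k τ = ⊆-trans (lookup∷⊆drop w k τ) (drop⁺-≥ b<k)

ABAB⇒Contains1212or2121 : ∀ w → ContainsABAB w → Contains1212or2121 w
ABAB⇒Contains1212or2121 w (x , y , x≢y , τ) =
  let (i , _   , wᵢ≡x , τ₁) = ∷⊆drop⁻ 0 w τ
      (j , i<j , wⱼ≡y , τ₂) = ∷⊆drop⁻ _ w τ₁
      (l , j<l , wₗ≡x , τ₃) = ∷⊆drop⁻ _ w τ₂
      (m , l<m , wₘ≡y , _)  = ∷⊆drop⁻ _ w τ₃
  in i , j , l , m , i<j , j<l , l<m , trans wᵢ≡x (sym wₗ≡x) , trans wⱼ≡y (sym wₘ≡y) ,
     λ wᵢ≡wⱼ → x≢y (trans (sym wᵢ≡x) (trans wᵢ≡wⱼ wⱼ≡y))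

abab⊆++⁻ : ∀ {x y} s r → Disjoint s r → abab x y ⊆ s ++ r → abab x y ⊆ s ⊎ abab x y ⊆ r
abab⊆++⁻ s r s#r τ with ⊆-++⁻ s r τ
... | []                    , _     , refl , _  , τr = inj₂ τr
... | _ ∷ []                , _     , refl , τs , τr = contradiction (to∈ τs , to∈ (∷ˡ⁻ τr)) s#r
... | _ ∷ _ ∷ []            , _     , refl , τs , τr = contradiction (to∈ τs , to∈ τr) s#r
... | _ ∷ _ ∷ _ ∷ []        , _     , refl , τs , τr = contradiction (to∈ (∷ˡ⁻ τs) , to∈ τr) s#r
... | _ ∷ _ ∷ _ ∷ _ ∷ []    , []    , refl , τs , _  = inj₁ τs
... | _ ∷ _ ∷ _ ∷ _ ∷ []    , _ ∷ _ , ()   , _  , _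
... | _ ∷ _ ∷ _ ∷ _ ∷ _ ∷ _ , _     , ()   , _  , _

aba⊆++⁻ : ∀ {y a} s r → Disjoint s r → a ∉ s → aba y a ⊆ s ++ r → aba y a ⊆ r
aba⊆++⁻ s r s#r a∉s τ with ⊆-++⁻ s r τ
... | []                , _ , refl , _  , τr = τr
... | _ ∷ []            , _ , refl , τs , τr = contradiction (to∈ τs , to∈ (∷ˡ⁻ τr)) s#r
... | _ ∷ _ ∷ []        , _ , refl , τs , _  = contradiction (to∈ (∷ˡ⁻ τs)) a∉s
... | _ ∷ _ ∷ _ ∷ []    , _ , refl , τs , _  = contradiction (to∈ (∷ˡ⁻ τs)) a∉s
... | _ ∷ _ ∷ _ ∷ _ ∷ _ , _ , ()   , _  , _

-- Encoding trees as words

mutual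
  encode : ∀ {k} → Tree k → List ℕ
  encode leaf        = []
  encode (node a ts) = encodeChildren a ts

  encodeChildren : ∀ {k j} → ℕ → Vec (Tree k) j → List ℕ
  encodeChildren a []       = []
  encodeChildren a (t ∷ ts) = a ∷ encode t ++ encodeChildren a ts

mutual
  count-encode : ∀ {k} z (t : Tree k) → count z (encode t) ≡ k * count z (labels t)
  count-encode {k} z leaf        = sym (*-zeroʳ k)
  count-encode {k} z (node a ts) = trans (count-encodeChildren z a ts) (sym (*-distribˡ-+ k (δ z a) _))

  count-encodeChildren : ∀ {k j} z a (ts : Vec (Tree k) j) →
                         count z (encodeChildren a ts) ≡ j * δ z a + k * count z (labelsVec ts)
  count-encodeChildren {k} z a [] = sym (*-zeroʳ k)
  count-encodeChildren {k} {suc j} z a (t ∷ ts) = begin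
    δ z a + count z (encode t ++ encodeChildren a ts)
      ≡⟨ cong (δ z a +_) (count-++ z (encode t) _) ⟩
    δ z a + (count z (encode t) + count z (encodeChildren a ts))
      ≡⟨ cong₂ (λ c d → δ z a + (c + d)) (count-encode z t) (count-encodeChildren z a ts) ⟩
    δ z a + (k * count z (labels t) + (j * δ z a + k * count z (labelsVec ts)))
      ≡⟨ rearrange (δ z a) j k (count z (labels t)) (count z (labelsVec ts)) ⟩
    (δ z a + j * δ z a) + k * (count z (labels t) + count z (labelsVec ts))
      ≡⟨ cong (λ c → (δ z a + j * δ z a) + k * c) (count-++ z (labels t) _) ⟨
    (δ z a + j * δ z a) + k * count z (labels t ++ labelsVec ts)
      ∎
    where
    open ≡-Reasoning
    rearrange : ∀ d j k c e → d + (k * c + (j * d + k * e)) ≡ (d + j * d) + k * (c + e)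
    rearrange = solve-∀

mutual
  ∈-encode⁻ : ∀ {k z} (t : Tree k) → z ∈ encode t → z ∈ labels t
  ∈-encode⁻ (node a ts) = ∈-encodeChildren⁻ ts

  ∈-encodeChildren⁻ : ∀ {k j z a} (ts : Vec (Tree k) j) → z ∈ encodeChildren a ts → z ∈ a ∷ labelsVec ts
  ∈-encodeChildren⁻ (t ∷ ts) (here z≡a) = here z≡a
  ∈-encodeChildren⁻ (t ∷ ts) (there z∈) with ∈-++⁻ (encode t) z∈
  ... | inj₁ z∈t  = there (∈-++⁺ˡ (∈-encode⁻ t z∈t))
  ... | inj₂ z∈ts with ∈-encodeChildren⁻ ts z∈ts
  ...   | here z≡a    = here z≡a
  ...   | there z∈ts′ = there (∈-++⁺ʳ (labels t) z∈ts′)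

encode-disjoint : ∀ {k j} a (t : Tree k) (ts : Vec (Tree k) j) →
                  Distinct (a ∷ labels t ++ labelsVec ts) → Disjoint (encode t) (a ∷ encodeChildren a ts)
encode-disjoint a t ts d (z∈t , z∈ats) =
  distinct-++⇒disjoint (labels t) (a ∷ labelsVec ts) (distinct-resp-↭ (shift a (labels t) (labelsVec ts)) d)
    (∈-encode⁻ t z∈t , ∈-aChildren z∈ats)
  where
  ∈-aChildren : ∀ {z} → z ∈ a ∷ encodeChildren a ts → z ∈ a ∷ labelsVec ts
  ∈-aChildren (here z≡a) = here z≡a
  ∈-aChildren (there z∈) = ∈-encodeChildren⁻ ts z∈

-- An occurrence of abab that starts at the letter a of a vertex leaves y a y behind it.
encodeChildren-aba-free : ∀ {k j} a (ts : Vec (Tree k) j) → Distinct (a ∷ labelsVec ts) →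
                          ∀ {y} → y ≢ a → aba y a ⊈ encodeChildren a ts
encodeChildren-aba-free a (t ∷ ts) d y≢a (refl ∷ _) = y≢a refl
encodeChildren-aba-free a (t ∷ ts) d y≢a (.a ∷ʳ τ)  =
  let (a∉t , t#ts) = disjoint-∷ʳ⁻ (encode-disjoint a t ts d)
  in encodeChildren-aba-free a ts (distinct-∷-++⁻ʳ a (labels t) _ d) y≢a (aba⊆++⁻ (encode t) _ t#ts a∉t τ)

mutual
  encode-ABAB-free : ∀ {k} (t : Tree k) → Distinct (labels t) → ¬ ContainsABAB (encode t)
  encode-ABAB-free leaf        _ (_ , _ , _ , ())
  encode-ABAB-free (node a ts) d = encodeChildren-ABAB-free a ts d

  encodeChildren-ABAB-free : ∀ {k j} a (ts : Vec (Tree k) j) → Distinct (a ∷ labelsVec ts) →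
                             ¬ ContainsABAB (encodeChildren a ts)
  encodeChildren-ABAB-free a []       _ (_ , _ , _ , ())
  encodeChildren-ABAB-free a (t ∷ ts) d (x , y , x≢y , refl ∷ τ) =
    let (a∉t , t#ts) = disjoint-∷ʳ⁻ (encode-disjoint a t ts d)
    in encodeChildren-aba-free a ts (distinct-∷-++⁻ʳ a (labels t) _ d) (x≢y ∘′ sym)
         (aba⊆++⁻ (encode t) _ t#ts a∉t τ)
  encodeChildren-ABAB-free a (t ∷ ts) d (x , y , x≢y , .a ∷ʳ τ)
    with abab⊆++⁻ (encode t) _ (proj₂ (disjoint-∷ʳ⁻ (encode-disjoint a t ts d))) τ
  ... | inj₁ τt  =
    encode-ABAB-free t (distinct-++⁻ˡ (labels t) (labelsVec ts) (proj₂ (distinct-∷⁻ a (labels t ++ labelsVec ts) d)))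
      (x , y , x≢y , τt)
  ... | inj₂ τts =
    encodeChildren-ABAB-free a ts (distinct-∷-++⁻ʳ a (labels t) _ d) (x , y , x≢y , τts)

splitOn : ∀ j → ℕ → List ℕ → Vec (List ℕ) (suc j)
splitOn zero    a w = w ∷ []
splitOn (suc j) a w = let (p , q) = breakAt a w in p ∷ splitOn j a q

splitOn-encodeChildren : ∀ {k j} a t (ts : Vec (Tree k) j) → a ∉ labels t ++ labelsVec ts →
                         splitOn j a (encode t ++ encodeChildren a ts) ≡ V.map encode (t ∷ ts)
splitOn-encodeChildren a t []       _  = cong (_∷ []) (++-identityʳ (encode t))
splitOn-encodeChildren a t (s ∷ ts) a∉ = begin
  splitOn _ a (encode t ++ a ∷ encode s ++ encodeChildren a ts)
    ≡⟨ cong (λ (p , q) → p ∷ splitOn _ a q) (breakAt-++ (encode t) _ (a∉ ∘′ ∈-++⁺ˡ ∘′ ∈-encode⁻ t)) ⟩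
  encode t ∷ splitOn _ a (encode s ++ encodeChildren a ts)
    ≡⟨ cong (encode t ∷_) (splitOn-encodeChildren a s ts (a∉ ∘′ ∈-++⁺ʳ (labels t))) ⟩
  V.map encode (t ∷ s ∷ ts)
    ∎
  where open ≡-Reasoning

encodeChildren-injective : ∀ {k j} a b (ts us : Vec (Tree k) (suc j)) → a ∉ labelsVec ts → b ∉ labelsVec us →
                           encodeChildren a ts ≡ encodeChildren b us → a ≡ b × V.map encode ts ≡ V.map encode us
encodeChildren-injective a b (t ∷ ts) (u ∷ us) a∉ b∉ e with ∷-injective e
... | refl , e′ = refl , (begin
  V.map encode (t ∷ ts)                           ≡⟨ splitOn-encodeChildren a t ts a∉ ⟨
  splitOn _ a (encode t ++ encodeChildren a ts)   ≡⟨ cong (splitOn _ a) e′ ⟩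
  splitOn _ a (encode u ++ encodeChildren a us)   ≡⟨ splitOn-encodeChildren a u us b∉ ⟩
  V.map encode (u ∷ us)                           ∎)
  where open ≡-Reasoning

mutual
  encode-injective : ∀ {m} (t u : Tree (suc m)) → Distinct (labels t) → Distinct (labels u) →
                     encode t ≡ encode u → t ≡ u
  encode-injective leaf             leaf             _  _  _ = refl
  encode-injective leaf             (node _ (_ ∷ _)) _  _  ()
  encode-injective (node _ (_ ∷ _)) leaf             _  _  ()
  encode-injective (node a ts)      (node b us)      dt du e =
    let (a∉ts , dts)  = distinct-∷⁻ a _ dt
        (b∉us , dus)  = distinct-∷⁻ b _ du
        (a≡b , ts≈us) = encodeChildren-injective a b ts us a∉ts b∉us e
    in cong₂ node a≡b (map-encode-injective ts us dts dus ts≈us)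

  map-encode-injective : ∀ {m j} (ts us : Vec (Tree (suc m)) j) → Distinct (labelsVec ts) → Distinct (labelsVec us) →
                         V.map encode ts ≡ V.map encode us → ts ≡ us
  map-encode-injective []       []       _  _  _ = refl
  map-encode-injective (t ∷ ts) (u ∷ us) dt du e =
    cong₂ _∷_
      (encode-injective t u (distinct-++⁻ˡ (labels t) _ dt) (distinct-++⁻ˡ (labels u) _ du) (V.∷-injectiveˡ e))
      (map-encode-injective ts us (distinct-++⁻ʳ (labels t) _ dt) (distinct-++⁻ʳ (labels u) _ du) (V.∷-injectiveʳ e))

labels↭⇒encode↭ : ∀ {k xs} (t : Tree k) → labels t ↭ xs → encode t ↭ concatMap (replicate k) xs
labels↭⇒encode↭ {k} {xs} t l = count≡⇒↭ _ _ λ z → begin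
  count z (encode t)                     ≡⟨ count-encode z t ⟩
  k * count z (labels t)                 ≡⟨ cong (k *_) (↭⇒count≡ l z) ⟩
  k * count z xs                         ≡⟨ count-concatMap-replicate z k xs ⟨
  count z (concatMap (replicate k) xs)   ∎
  where open ≡-Reasoning

encode↭⇒labels↭ : ∀ {m xs} (t : Tree (suc m)) → encode t ↭ concatMap (replicate (suc m)) xs → labels t ↭ xs
encode↭⇒labels↭ {m} {xs} t e = count≡⇒↭ _ _ λ z → *-cancelˡ-≡ _ _ (suc m) (begin
  suc m * count z (labels t)                   ≡⟨ count-encode z t ⟨
  count z (encode t)                           ≡⟨ ↭⇒count≡ e z ⟩
  count z (concatMap (replicate (suc m)) xs)   ≡⟨ count-concatMap-replicate z (suc m) xs ⟩
  suc m * count z xs                           ∎)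
  where open ≡-Reasoning

-- Decoding words as trees

-- The fuel f only has to be at least the length of the word.
decode : ∀ {m} → ℕ → List ℕ → Tree (suc m)
decode zero    _       = leaf
decode (suc f) []      = leaf
decode (suc f) (a ∷ w) = node a (V.map (decode f) (splitOn _ a w))

IsQuasiStirling : ℕ → List ℕ → Set
IsQuasiStirling k w = ¬ ContainsABAB w × (∀ z → Uniform k w z)

-- a ∷ r is what remains of the word of a vertex a after some of its subtrees
-- have been read off, with j + 1 subtrees still to come.
IsNodeWord : ℕ → ℕ → ℕ → List ℕ → Set
IsNodeWord k a j r = ¬ ContainsABAB (a ∷ r) × (∀ z → z ≢ a → Uniform k r z) × count a r ≡ j

isQuasiStirling-∷⁻ : ∀ {m a} w → IsQuasiStirling (suc m) (a ∷ w) → IsNodeWord (suc m) a m w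
isQuasiStirling-∷⁻ {m} {a} w (free , u) = free , (λ z z≢a → uniform-there w z≢a (u z)) , count-a
  where
  count-a : count a w ≡ m
  count-a with u a
  ... | inj₁ none = contradiction (trans (sym (count-here a w)) none) λ ()
  ... | inj₂ all  = suc-injective (trans (sym (count-here a w)) all)

isNodeWord-last : ∀ {k a} r → IsNodeWord k a 0 r → IsQuasiStirling k r
isNodeWord-last {a = a} r (free , u , none) =
  free ∘′ containsABAB-mono (a ∷ʳ ⊆-refl) ,
  λ z → case z ≟ a of λ where
    (yes refl) → inj₁ none
    (no z≢a)   → u z z≢a

ABAB-free⇒disjoint : ∀ a p q → a ∉ p → ¬ ContainsABAB (a ∷ p ++ a ∷ q) → Disjoint p (a ∷ q)
ABAB-free⇒disjoint a p q a∉p _    (y∈p , here refl) = a∉p y∈p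
ABAB-free⇒disjoint a p q a∉p free (y∈p , there y∈q) =
  free (a , _ , (λ { refl → a∉p y∈p }) , refl ∷ ++⁺ (from∈ y∈p) (refl ∷ from∈ y∈q))

isNodeWord-breakAt : ∀ {k a j} r → IsNodeWord k a (suc j) r → let (p , q) = breakAt a r in
                     r ≡ p ++ a ∷ q × IsQuasiStirling k p × IsNodeWord k a j q
isNodeWord-breakAt {k} {a} {j} r (free , u , count-a) =
  r≡ , (free ∘′ containsABAB-mono p⊆ , uniform-p) , (free ∘′ containsABAB-mono aq⊆ , uniform-q , count-q)
  where
  p = proj₁ (breakAt a r)
  q = proj₂ (breakAt a r)
  spec = breakAt-spec r (0<count⇒∈ (subst (0 <_) (sym count-a) (s≤s z≤n)))
  r≡ : r ≡ p ++ a ∷ q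
  r≡ = proj₁ spec
  a∉p : a ∉ p
  a∉p = proj₂ spec
  p⊆ : p ⊆ a ∷ r
  p⊆ = a ∷ʳ subst (p ⊆_) (sym r≡) (++⁺ʳ (a ∷ q) ⊆-refl)
  aq⊆ : a ∷ q ⊆ a ∷ r
  aq⊆ = refl ∷ subst (q ⊆_) (sym r≡) (++⁺ˡ p (a ∷ʳ ⊆-refl))
  uniform-p-aq : ∀ z → z ≢ a → Uniform k p z × Uniform k (a ∷ q) z
  uniform-p-aq z z≢a =
    uniform-++ p (a ∷ q) (ABAB-free⇒disjoint a p q a∉p (subst (λ w → ¬ ContainsABAB (a ∷ w)) r≡ free)) z
      (subst (λ w → Uniform k w z) r≡ (u z z≢a))
  uniform-p : ∀ z → Uniform k p z
  uniform-p z = case z ≟ a of λ where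
    (yes refl) → inj₁ (∉⇒count≡0 a∉p)
    (no z≢a)   → proj₁ (uniform-p-aq z z≢a)
  uniform-q : ∀ z → z ≢ a → Uniform k q z
  uniform-q z z≢a = uniform-there q z≢a (proj₂ (uniform-p-aq z z≢a))
  count-q : count a q ≡ j
  count-q = suc-injective (begin
    suc (count a q)             ≡⟨ count-here a q ⟨
    count a (a ∷ q)             ≡⟨ cong (_+ count a (a ∷ q)) (∉⇒count≡0 a∉p) ⟨
    count a p + count a (a ∷ q) ≡⟨ count-++ a p (a ∷ q) ⟨
    count a (p ++ a ∷ q)        ≡⟨ cong (count a) r≡ ⟨
    count a r                   ≡⟨ count-a ⟩
    suc j                       ∎)
    where open ≡-Reasoning

mutual
  encode-decode : ∀ {m} f w → length w ≤ f → IsQuasiStirling (suc m) w → encode (decode {m} f w) ≡ w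
  encode-decode zero    []      _         _  = refl
  encode-decode (suc f) []      _         _  = refl
  encode-decode (suc f) (a ∷ w) (s≤s w≤f) qs = encodeChildren-decode f a w w≤f (isQuasiStirling-∷⁻ w qs)

  encodeChildren-decode : ∀ {m j} f a r → length r ≤ f → IsNodeWord (suc m) a j r →
                          encodeChildren a (V.map (decode {m} f) (splitOn j a r)) ≡ a ∷ r
  encodeChildren-decode {j = zero} f a r r≤f nw =
    cong (a ∷_) (trans (++-identityʳ _) (encode-decode f r r≤f (isNodeWord-last r nw)))
  encodeChildren-decode {j = suc j} f a r r≤f nw =
    let (r≡ , qs-p , nw-q) = isNodeWord-breakAt r nw
        pq≤f = subst (λ w → length w ≤ f) r≡ r≤f
        p≤f  = ≤-trans (length-++-≤ˡ p) pq≤f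
        q≤f  = ≤-trans (n≤1+n _) (≤-trans (length-++-≤ʳ (a ∷ q) {p}) pq≤f)
    in cong (a ∷_) (trans (cong₂ _++_ (encode-decode f p p≤f qs-p) (encodeChildren-decode f a q q≤f nw-q)) (sym r≡))
    where
    p = proj₁ (breakAt a r)
    q = proj₂ (breakAt a r)

mutual
  _≟ᵀ_ : ∀ {k} → DecidableEquality (Tree k)
  leaf      ≟ᵀ leaf      = yes refl
  leaf      ≟ᵀ node _ _  = no λ ()
  node _ _  ≟ᵀ leaf      = no λ ()
  node a ts ≟ᵀ node b us =
    map′ (λ (a≡b , ts≡us) → cong₂ node a≡b ts≡us) (λ { refl → refl , refl }) (a ≟ b ×-dec ts ≟ⱽ us)

  _≟ⱽ_ : ∀ {k j} → DecidableEquality (Vec (Tree k) j)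
  []       ≟ⱽ []       = yes refl
  (t ∷ ts) ≟ⱽ (u ∷ us) =
    map′ (λ (t≡u , ts≡us) → cong₂ _∷_ t≡u ts≡us) (λ { refl → refl , refl }) (t ≟ᵀ u ×-dec ts ≟ⱽ us)

mkTree-cong : ∀ {k n t u} .{l : labels t ↭ [1‥ n ]} .{l′ : labels u ↭ [1‥ n ]} →
              t ≡ u → mkTree {k} {n} t l ≡ mkTree u l′
mkTree-cong refl = refl

mkQS-cong : ∀ {k n v w} .{p : v ↭ multiset k n} .{p′ : w ↭ multiset k n}
              .{a : ¬ Contains1212or2121 v} .{a′ : ¬ Contains1212or2121 w} →
            v ≡ w → mkQS {k} {n} v p a ≡ mkQS w p′ a′
mkQS-cong refl = refl

module _ (m n : ℕ) where

  private
    labels-distinct : ∀ (t : Tree (suc m)) → labels t ↭ [1‥ n ] → Distinct (labels t)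
    labels-distinct t l = distinct-resp-↭ {labels t} l (distinct-[1‥] n)

    isQuasiStirling : ∀ w → w ↭ multiset (suc m) n → ¬ Contains1212or2121 w → IsQuasiStirling (suc m) w
    isQuasiStirling w p avoids =
      avoids ∘′ ABAB⇒Contains1212or2121 w , uniform-concatMap-replicate {xs = [1‥ n ]} (distinct-[1‥] n) p

    encode-decode-word : ∀ w → w ↭ multiset (suc m) n → ¬ Contains1212or2121 w →
                         encode (decode {m} (length w) w) ≡ w
    encode-decode-word w p avoids = encode-decode (length w) w ≤-refl (isQuasiStirling w p avoids)

  toQuasiStirling : KAryTree (suc m) n → QuasiStirling (suc m) n
  toQuasiStirling (mkTree t l) =
    mkQS (encode t) (labels↭⇒encode↭ t l)
         (encode-ABAB-free t (labels-distinct t l) ∘′ Contains1212or2121⇒ABAB (encode t))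

  -- The labelling and avoidance proofs are irrelevant, so equations derived
  -- from them are recomputed by deciding equality.
  toQuasiStirling-injective : Injective _≡_ _≡_ toQuasiStirling
  toQuasiStirling-injective {mkTree t l} {mkTree u l′} e =
    mkTree-cong (recompute (t ≟ᵀ u)
      (encode-injective t u (labels-distinct t l) (labels-distinct u l′) (cong QuasiStirling.word e)))

  toQuasiStirling-surjective : Surjective _≡_ _≡_ toQuasiStirling
  toQuasiStirling-surjective (mkQS w p avoids) =
    mkTree (decode (length w) w)
      (encode↭⇒labels↭ (decode (length w) w)
        (subst (_↭ multiset (suc m) n) (sym (encode-decode-word w p avoids)) p)) ,
    λ { refl → mkQS-cong (recompute (≡-dec _≟_ _ w) (encode-decode-word w p avoids)) }

theorem4p1 : (k : ℕ) → 1 ≤ k → (n : ℕ) → KAryTree k n ⤖ QuasiStirling k n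
theorem4p1 (suc m) _ n = mk⤖ (toQuasiStirling-injective m n , toQuasiStirling-surjective m n)
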